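{- For every sentence $A\in\mathsf{Sent}_Q$: if $|^{+}A$ then $\vdash_{i3}A$.
   Context: $\mathcal{L}_Q$: first-order language with $\bot,{\sim},\land,\lor,\to,\forall,\exists$, a countable set $\mathsf{Con}$ of constants, variables, predicate symbols; $\mathsf{Sent}_Q$ its sentences; $\neg A:=A\to\bot$, $A\leftrightarrow B:=(A\to B)\land(B\to A)$. $\vdash_{i3}$ is derivability (from no premises) in the Hilbert system $\mathbf{QBDi3}$ with axioms (Ax1) $A\to(B\to A)$; (Ax2) $(A\to(B\to C))\to((A\to B)\to(A\to C))$; (Ax4) $(A\land B)\to A$; (Ax5) $(A\land B)\to B$; (Ax6) $(C\to A)\to((C\to B)\to(C\to(A\land B)))$; (Ax7) $A\to(A\lor B)$; (Ax8) $B\to(A\lor B)$; (Ax9) $(A\to C)\to((B\to C)\to((A\lor B)\to C))$; (Ax10) $\bot\to A$; (Ax11) $A(t)\to\exists xA$; (Ax12) $\forall x(A(x)\to B)\to(\exists xA(x)\to B)$ ($x$ not free in $B$); (Ax13) $\forall x(B\to A)\to(B\to\forall xA)$ ($x$ not free in $B$); (Ax14) $\forall xA\to A(t)$; (Ax15) $A\to{\sim}\bot$; (Ax16) ${\sim}{\sim}A\leftrightarrow A$; (Ax17) ${\sim}(A\land B)\leftrightarrow({\sim}A\lor{\sim}B)$; (Ax18) ${\sim}(A\lor B)\leftrightarrow({\sim}A\land{\sim}B)$; (Ax19) ${\sim}(A\to B)\leftrightarrow(\neg{\sim}A\land{\sim}B)$; (Ax20) ${\sim}\forall xA\leftrightarrow\exists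 x{\sim}A$; (Ax21) ${\sim}\exists xA\leftrightarrow\forall x{\sim}A$; (i1) $\forall x\neg\neg A\to\neg\neg\forall xA$; (i2) ${\sim}A\to\neg A$; (i3) $\neg\neg(A\lor{\sim}A)$; rules MP and Gen (from $A$ infer $\forall xA$). Slashes $|^{+}A$, $|^{ - }A$ for sentences, defined simultaneously by recursion: $|^{+}P(\vec t)$ iff $\vdash_{i3}P(\vec t)$; $|^{ - }P(\vec t)$ iff $\vdash_{i3}{\sim}P(\vec t)$; not $|^{+}\bot$; $|^{ - }\bot$; $|^{+}{\sim}A$ iff $|^{ - }A$; $|^{ - }{\sim}A$ iff $|^{+}A$; $|^{+}A\land B$ iff $|^{+}A$ and $|^{+}B$; $|^{ - }A\land B$ iff $|^{ - }A$ or $|^{ - }B$; $|^{+}A\lor B$ iff $|^{+}A$ or $|^{+}B$; $|^{ - }A\lor B$ iff $|^{ - }A$ and $|^{ - }B$; $|^{+}A\to B$ iff $\vdash_{i3}A\to B$ and ($|^{+}A$ implies $|^{+}B$); $|^{ - }A\to B$ iff $\vdash_{i3}\neg{\sim}A$ and $|^{ - }B$; $|^{+}\forall xA$ iff $\vdash_{i3}\forall xA$ and $|^{+}A(c)$ for all $c\in\mathsf{Con}$; $|^{ - }\forall xA$ iff $|^{ - }A(c)$ for some $c\in\mathsf{Con}$; $|^{+}\exists xA$ iff $|^{+}A(c)$ for some $c\in\mathsf{Con}$; $|^{ - }\exists xA$ iff $\vdash_{i3}{\sim}\exists xA$ and $|^{ - }A(c)$ for all $c\in\mathsf{Con}$.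 -}

module Defs where

open import Data.Nat using (ℕ; zero; suc; _<_)
open import Data.List using (List; map)
open import Data.List.Relation.Unary.All using (All)
open import Data.Product using (Σ; _×_)
open import Data.Sum using (_⊎_)
open import Data.Empty using (⊥)
open import Data.Unit using (⊤)

-- Variables are de Bruijn indices (ℕ); the countable
-- set Con of constants is ℕ; predicate symbols are named by ℕ and applied
-- to a list of terms.

data Tm : Set where
  var : ℕ → Tm
  con : ℕ → Tm

infixr 5 _⇒_
infixr 6 _∨'_
infixr 7 _∧'_

data Fm : Set where
  atom : ℕ → List Tm → Fm
  ⊥'   : Fm
  ∼_   : Fm → Fm
  _∧'_ : Fm → Fm → Fm
  _∨'_ : Fm → Fm → Fm
  _⇒_  : Fm → Fm → Fm
  all  : Fm → Fm
  ex   : Fm → Fm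

¬'_ : Fm → Fm
¬' A = A ⇒ ⊥'

_⇔_ : Fm → Fm → Fm
A ⇔ B = (A ⇒ B) ∧' (B ⇒ A)

Sub : Set
Sub = ℕ → Tm

shiftTm : Tm → Tm
shiftTm (var i) = var (suc i)
shiftTm (con c) = con c

substTm : Sub → Tm → Tm
substTm σ (var i) = σ i
substTm σ (con c) = con c

lift : Sub → Sub
lift σ zero    = var zero
lift σ (suc i) = shiftTm (σ i)

subst : Sub → Fm → Fm
subst σ (atom p ts) = atom p (map (substTm σ) ts)
subst σ ⊥'          = ⊥'
subst σ (∼ A)       = ∼ subst σ A
subst σ (A ∧' B)    = subst σ A ∧' subst σ B
subst σ (A ∨' B)    = subst σ A ∨' subst σ B
subst σ (A ⇒ B)     = subst σ A ⇒ subst σ B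
subst σ (all A)     = all (subst (lift σ) A)
subst σ (ex A)      = ex (subst (lift σ) A)

extend : Tm → Sub → Sub
extend t σ zero    = t
extend t σ (suc i) = σ i

inst : Fm → Tm → Fm
inst A t = subst (extend t var) A

-- weakening: used for "x not free in B"
wk : Fm → Fm
wk B = subst (λ i → var (suc i)) B

TmBelow : ℕ → Tm → Set
TmBelow k (var i) = i < k
TmBelow k (con c) = ⊤

FmBelow : ℕ → Fm → Set
FmBelow k (atom p ts) = All (TmBelow k) ts
FmBelow k ⊥'          = ⊤
FmBelow k (∼ A)       = FmBelow k A
FmBelow k (A ∧' B)    = FmBelow k A × FmBelow k B
FmBelow k (A ∨' B)    = FmBelow k A × FmBelow k B
FmBelow k (A ⇒ B)     = FmBelow k A × FmBelow k B
FmBelow k (all A)     = FmBelow (suc k) A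
FmBelow k (ex A)      = FmBelow (suc k) A

Sentence : Fm → Set
Sentence A = FmBelow zero A

infix 3 ⊢_

data ⊢_ : Fm → Set where
  ax1  : ∀ A B → ⊢ A ⇒ (B ⇒ A)
  ax2  : ∀ A B C → ⊢ (A ⇒ (B ⇒ C)) ⇒ ((A ⇒ B) ⇒ (A ⇒ C))
  ax4  : ∀ A B → ⊢ (A ∧' B) ⇒ A
  ax5  : ∀ A B → ⊢ (A ∧' B) ⇒ B
  ax6  : ∀ A B C → ⊢ (C ⇒ A) ⇒ ((C ⇒ B) ⇒ (C ⇒ (A ∧' B)))
  ax7  : ∀ A B → ⊢ A ⇒ (A ∨' B)
  ax8  : ∀ A B → ⊢ B ⇒ (A ∨' B)
  ax9  : ∀ A B C → ⊢ (A ⇒ C) ⇒ ((B ⇒ C) ⇒ ((A ∨' B) ⇒ C))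
  ax10 : ∀ A → ⊢ ⊥' ⇒ A
  ax11 : ∀ A t → ⊢ inst A t ⇒ ex A
  ax12 : ∀ A B → ⊢ all (A ⇒ wk B) ⇒ (ex A ⇒ B)
  ax13 : ∀ A B → ⊢ all (wk B ⇒ A) ⇒ (B ⇒ all A)
  ax14 : ∀ A t → ⊢ all A ⇒ inst A t
  ax15 : ∀ A → ⊢ A ⇒ ∼ ⊥'
  ax16 : ∀ A → ⊢ (∼ ∼ A) ⇔ A
  ax17 : ∀ A B → ⊢ (∼ (A ∧' B)) ⇔ ((∼ A) ∨' (∼ B))
  ax18 : ∀ A B → ⊢ (∼ (A ∨' B)) ⇔ ((∼ A) ∧' (∼ B))
  ax19 : ∀ A B → ⊢ (∼ (A ⇒ B)) ⇔ ((¬' (∼ A)) ∧' (∼ B))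
  ax20 : ∀ A → ⊢ (∼ all A) ⇔ ex (∼ A)
  ax21 : ∀ A → ⊢ (∼ ex A) ⇔ all (∼ A)
  i1   : ∀ A → ⊢ all (¬' ¬' A) ⇒ ¬' ¬' all A
  i2   : ∀ A → ⊢ (∼ A) ⇒ ¬' A
  i3   : ∀ A → ⊢ ¬' ¬' (A ∨' (∼ A))
  mp   : ∀ {A B} → ⊢ A ⇒ B → ⊢ A → ⊢ B
  gen  : ∀ {A} → ⊢ A → ⊢ all A

-- To get structural recursion, SlashP ρ A / SlashN ρ A is the slash of the
-- formula  subst ρ A  (so "A(c)" for a quantifier body becomes the
-- environment  extend (con c) ρ; note subst (extend (con c) ρ) A is
-- literally inst (subst (lift ρ) A) (con c) up to substitution algebra).

mutual
  SlashP : Sub → Fm → Set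
  SlashP ρ (atom p ts) = ⊢ subst ρ (atom p ts)
  SlashP ρ ⊥'          = ⊥
  SlashP ρ (∼ A)       = SlashN ρ A
  SlashP ρ (A ∧' B)    = SlashP ρ A × SlashP ρ B
  SlashP ρ (A ∨' B)    = SlashP ρ A ⊎ SlashP ρ B
  SlashP ρ (A ⇒ B)     = (⊢ subst ρ (A ⇒ B)) × (SlashP ρ A → SlashP ρ B)
  SlashP ρ (all A)     = (⊢ subst ρ (all A)) × ((c : ℕ) → SlashP (extend (con c) ρ) A)
  SlashP ρ (ex A)      = Σ ℕ (λ c → SlashP (extend (con c) ρ) A)

  SlashN : Sub → Fm → Set
  SlashN ρ (atom p ts) = ⊢ ∼ subst ρ (atom p ts)
  SlashN ρ ⊥'          = ⊤
  SlashN ρ (∼ A)       = SlashP ρ A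
  SlashN ρ (A ∧' B)    = SlashN ρ A ⊎ SlashN ρ B
  SlashN ρ (A ∨' B)    = SlashN ρ A × SlashN ρ B
  SlashN ρ (A ⇒ B)     = (⊢ ¬' (∼ subst ρ A)) × SlashN ρ B
  SlashN ρ (all A)     = Σ ℕ (λ c → SlashN (extend (con c) ρ) A)
  SlashN ρ (ex A)      = (⊢ ∼ subst ρ (ex A)) × ((c : ℕ) → SlashN (extend (con c) ρ) A)

|⁺_ : Fm → Set
|⁺ A = SlashP var A

|⁻_ : Fm → Set
|⁻ A = SlashN var A

-- Soundness of the positive and negative slash at once: the clauses of |⁺ and |⁻
-- are exactly the introduction forms of the axioms, with ∼ pushed inward by the
-- equivalences Ax16–Ax21, and wherever a clause carries no such information
-- (implication, ∀, and the negative ∃) it stores the derivation itself.  The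
-- induction runs over formulas under a substitution, so quantifier bodies are
-- handled by the commutation of instantiation with lifting.
module Submission where

open import Defs
open import Data.Nat using (zero; suc)
open import Data.List.Properties using (map-cong; map-∘; map-id)
open import Data.Product using (_,_; proj₁)
open import Data.Sum using (inj₁; inj₂)
open import Relation.Binary.PropositionalEquality
  using (_≡_; _≗_; refl; sym; trans; cong; cong₂)
  renaming (subst to ≡-subst)

mp₂ : ∀ {A B C} → ⊢ A ⇒ (B ⇒ C) → ⊢ A → ⊢ B → ⊢ C
mp₂ f a b = mp (mp f a) b

⊢-id : ∀ A → ⊢ A ⇒ A
⊢-id A = mp₂ (ax2 A (A ⇒ A) A) (ax1 A (A ⇒ A)) (ax1 A A)

∧-intro : ∀ {A B} → ⊢ A → ⊢ B → ⊢ A ∧' B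
∧-intro {A} {B} a b = mp (mp₂ (ax6 A B A) (⊢-id A) (mp (ax1 B A) b)) a

⇔-mpʳ : ∀ {A B} → ⊢ A ⇔ B → ⊢ B → ⊢ A
⇔-mpʳ {A} {B} e = mp (mp (ax5 (A ⇒ B) (B ⇒ A)) e)

∼⊥-derivable : ⊢ ∼ ⊥'
∼⊥-derivable = mp (ax15 (⊥' ⇒ ⊥')) (⊢-id ⊥')

_∘ₛ_ : Sub → Sub → Sub
(σ ∘ₛ τ) i = substTm σ (τ i)

lift-cong : ∀ {σ τ} → σ ≗ τ → lift σ ≗ lift τ
lift-cong e zero    = refl
lift-cong e (suc i) = cong shiftTm (e i)

substTm-cong : ∀ {σ τ} → σ ≗ τ → substTm σ ≗ substTm τ
substTm-cong e (var i) = e i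
substTm-cong e (con c) = refl

subst-cong : ∀ {σ τ} → σ ≗ τ → subst σ ≗ subst τ
subst-cong e (atom p ts) = cong (atom p) (map-cong (substTm-cong e) ts)
subst-cong e ⊥'          = refl
subst-cong e (∼ A)       = cong ∼_ (subst-cong e A)
subst-cong e (A ∧' B)    = cong₂ _∧'_ (subst-cong e A) (subst-cong e B)
subst-cong e (A ∨' B)    = cong₂ _∨'_ (subst-cong e A) (subst-cong e B)
subst-cong e (A ⇒ B)     = cong₂ _⇒_ (subst-cong e A) (subst-cong e B)
subst-cong e (all A)     = cong all (subst-cong (lift-cong e) A)
subst-cong e (ex A)      = cong ex (subst-cong (lift-cong e) A)

substTm-∘ : ∀ σ τ t → substTm σ (substTm τ t) ≡ substTm (σ ∘ₛ τ) t
substTm-∘ σ τ (var i) = refl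
substTm-∘ σ τ (con c) = refl

substTm-lift-shiftTm : ∀ σ t → substTm (lift σ) (shiftTm t) ≡ shiftTm (substTm σ t)
substTm-lift-shiftTm σ (var i) = refl
substTm-lift-shiftTm σ (con c) = refl

lift-∘ : ∀ σ τ → lift σ ∘ₛ lift τ ≗ lift (σ ∘ₛ τ)
lift-∘ σ τ zero    = refl
lift-∘ σ τ (suc i) = substTm-lift-shiftTm σ (τ i)

subst-∘ : ∀ σ τ A → subst σ (subst τ A) ≡ subst (σ ∘ₛ τ) A
subst-∘ σ τ (atom p ts) =
  cong (atom p) (trans (sym (map-∘ ts)) (map-cong (substTm-∘ σ τ) ts))
subst-∘ σ τ ⊥'       = refl
subst-∘ σ τ (∼ A)    = cong ∼_ (subst-∘ σ τ A)
subst-∘ σ τ (A ∧' B) = cong₂ _∧'_ (subst-∘ σ τ A) (subst-∘ σ τ B)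
subst-∘ σ τ (A ∨' B) = cong₂ _∨'_ (subst-∘ σ τ A) (subst-∘ σ τ B)
subst-∘ σ τ (A ⇒ B)  = cong₂ _⇒_ (subst-∘ σ τ A) (subst-∘ σ τ B)
subst-∘ σ τ (all A)  =
  cong all (trans (subst-∘ (lift σ) (lift τ) A) (subst-cong (lift-∘ σ τ) A))
subst-∘ σ τ (ex A)   =
  cong ex (trans (subst-∘ (lift σ) (lift τ) A) (subst-cong (lift-∘ σ τ) A))

substTm-var : substTm var ≗ (λ t → t)
substTm-var (var i) = refl
substTm-var (con c) = refl

substTm-extend-shiftTm : ∀ s σ t → substTm (extend s σ) (shiftTm t) ≡ substTm σ t
substTm-extend-shiftTm s σ (var i) = refl
substTm-extend-shiftTm s σ (con c) = refl

inst-lift : ∀ ρ t A → inst (subst (lift ρ) A) t ≡ subst (extend t ρ) A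
inst-lift ρ t A = trans (subst-∘ (extend t var) (lift ρ) A) (subst-cong extend∘lift A)
  where
  extend∘lift : extend t var ∘ₛ lift ρ ≗ extend t ρ
  extend∘lift zero    = refl
  extend∘lift (suc i) = trans (substTm-extend-shiftTm t var (ρ i)) (substTm-var (ρ i))

lift-var : lift var ≗ var
lift-var zero    = refl
lift-var (suc i) = refl

subst-var : ∀ {σ} → σ ≗ var → subst σ ≗ (λ A → A)
subst-var e (atom p ts) =
  cong (atom p) (trans (map-cong (λ t → trans (substTm-cong e t) (substTm-var t)) ts) (map-id ts))
subst-var e ⊥'       = refl
subst-var e (∼ A)    = cong ∼_ (subst-var e A)
subst-var e (A ∧' B) = cong₂ _∧'_ (subst-var e A) (subst-var e B)
subst-var e (A ∨' B) = cong₂ _∨'_ (subst-var e A) (subst-var e B)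
subst-var e (A ⇒ B)  = cong₂ _⇒_ (subst-var e A) (subst-var e B)
subst-var e (all A)  = cong all (subst-var (λ i → trans (lift-cong e i) (lift-var i)) A)
subst-var e (ex A)   = cong ex (subst-var (λ i → trans (lift-cong e i) (lift-var i)) A)

⊢-inst-lift : ∀ ρ c A → ⊢ subst (extend (con c) ρ) A → ⊢ inst (subst (lift ρ) A) (con c)
⊢-inst-lift ρ c A = ≡-subst ⊢_ (sym (inst-lift ρ (con c) A))

mutual
  SlashP-sound : ∀ ρ A → SlashP ρ A → ⊢ subst ρ A
  SlashP-sound ρ (atom p ts) d        = d
  SlashP-sound ρ ⊥'          ()
  SlashP-sound ρ (∼ A)       s        = SlashN-sound ρ A s
  SlashP-sound ρ (A ∧' B)    (a , b)  = ∧-intro (SlashP-sound ρ A a) (SlashP-sound ρ B b)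
  SlashP-sound ρ (A ∨' B)    (inj₁ a) = mp (ax7 _ _) (SlashP-sound ρ A a)
  SlashP-sound ρ (A ∨' B)    (inj₂ b) = mp (ax8 _ _) (SlashP-sound ρ B b)
  SlashP-sound ρ (A ⇒ B)     s        = proj₁ s
  SlashP-sound ρ (all A)     s        = proj₁ s
  SlashP-sound ρ (ex A)      (c , s)  =
    mp (ax11 _ (con c)) (⊢-inst-lift ρ c A (SlashP-sound (extend (con c) ρ) A s))

  SlashN-sound : ∀ ρ A → SlashN ρ A → ⊢ ∼ subst ρ A
  SlashN-sound ρ (atom p ts) d        = d
  SlashN-sound ρ ⊥'          _        = ∼⊥-derivable
  SlashN-sound ρ (∼ A)       s        = ⇔-mpʳ (ax16 _) (SlashP-sound ρ A s)
  SlashN-sound ρ (A ∧' B)    (inj₁ a) = ⇔-mpʳ (ax17 _ _) (mp (ax7 _ _) (SlashN-sound ρ A a))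
  SlashN-sound ρ (A ∧' B)    (inj₂ b) = ⇔-mpʳ (ax17 _ _) (mp (ax8 _ _) (SlashN-sound ρ B b))
  SlashN-sound ρ (A ∨' B)    (a , b)  =
    ⇔-mpʳ (ax18 _ _) (∧-intro (SlashN-sound ρ A a) (SlashN-sound ρ B b))
  SlashN-sound ρ (A ⇒ B)     (n , b)  = ⇔-mpʳ (ax19 _ _) (∧-intro n (SlashN-sound ρ B b))
  SlashN-sound ρ (all A)     (c , s)  =
    ⇔-mpʳ (ax20 _)
      (mp (ax11 _ (con c)) (⊢-inst-lift ρ c (∼ A) (SlashN-sound (extend (con c) ρ) A s)))
  SlashN-sound ρ (ex A)      s        = proj₁ s

lemma3p9 : (A : Fm) → Sentence A → |⁺ A → ⊢ A
lemma3p9 A _ s = ≡-subst ⊢_ (subst-var (λ _ → refl) A) (SlashP-sound var A s)
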